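{- Let $k\geq1$. The linear map $\phi:\mathrm{PM}_k\to\mathrm{PM}_k^\star$ defined by $\phi(\mathbf F_M)=\mathbf F^\star_{M^T}$ for every $k$-packed matrix $M$ (where $M^T$ is the transpose of $M$) is an isomorphism of Hopf algebras.
   Context: Let $\mathbb K$ be a field of characteristic zero and $A_k=\{0,1,\dots,k\}$. A $k$-packed matrix of size $n\geq0$ is an $n\times n$ matrix with entries in $A_k$ such that every row and every column contains a nonzero entry; $\emptyset$ is the one of size $0$. $\mathrm{PM}_k$ has basis $\{\mathbf F_M\}$ indexed by all $k$-packed matrices, bigraded by (size, number of nonzero entries). Let $Z_a^b$ be the $a\times b$ zero matrix. For $M_1,M_2$ of sizes $n_1,n_2$ let $M_1\circ n_2=\begin{bmatrix}M_1\\ Z_{n_2}^{n_1}\end{bmatrix}$, $n_1\circ M_2=\begin{bmatrix}Z_{n_1}^{n_2}\\ M_2\end{bmatrix}$; the column shifted shuffle $M_1\sqcup\!\sqcup M_2$ is the set of matrices whose sequence of columns is a shuffle of the columns of $M_1\circ n_2$ with those of $n_1\circ M_2$; product $\mathbf F_{M_1}\cdot\mathbf F_{M_2}=\sum_{M\in M_1\sqcup\!\sqcup M_2}\mathbf F_M$. The compression $\mathrm{cp}(N)$ deletes all zero rows and columns of $N$. For $M$ of size $n$ and $0\le j\le n$, writing $M=[L\mid R]$ with $L$ the first $j$ columns, this is a column decomposition $M=L\bullet R$ if $\mathrm{cp}(L)$, $\mathrm{cp}(R)$ are square; coproduct $\Delta(\mathbf F_M)=\sum_{M=L\bullet R}\mathbf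 F_{\mathrm{cp}(L)}\otimes\mathbf F_{\mathrm{cp}(R)}$. This makes $\mathrm{PM}_k$ a Hopf algebra with finite-dimensional bihomogeneous components. $\mathrm{PM}_k^\star$ is its bigraded dual (direct sum of the duals of the bihomogeneous components) with the transposed Hopf structure, and $\{\mathbf F^\star_M\}$ is the basis dual to $\{\mathbf F_M\}$. -}

module Defs where

open import Level using (Level; _⊔_)
open import Algebra.Bundles using (CommutativeRing)
import Algebra.Bundles
import Algebra.Definitions.RawSemiring as RS
open import Data.Nat using (ℕ; zero; suc; _≡ᵇ_)
open import Data.Fin using (Fin)
import Data.Fin.Properties as FinP
import Data.List.Properties as ListP
open import Data.List using (List; []; _∷_; map; concatMap; mapMaybe; replicate; upTo;
  length; take; drop; foldr; _++_; [_])
open import Data.Bool using (Bool; true; false; not; _∧_; T; if_then_else_)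
open import Data.Bool.Properties using (T?)
open import Data.Maybe using (Maybe; just; nothing)
import Data.Maybe
open import Data.Product using (Σ; ∃; _×_; _,_; proj₁; proj₂)
open import Relation.Nullary using (¬_; yes; no; does)
open import Relation.Binary.PropositionalEquality using (_≡_)

record Field (c ℓ : Level) : Set (Level.suc (c ⊔ ℓ)) where
  field
    commutativeRing : CommutativeRing c ℓ
  open CommutativeRing commutativeRing public
  field
    0≉1     : ¬ (0# ≈ 1#)
    inverse : ∀ x → ¬ (x ≈ 0#) → Σ Carrier (λ y → x * y ≈ 1#)

module FieldOps {c ℓ} (K : Field c ℓ) where
  open Field K
  open RS (Algebra.Bundles.Semiring.rawSemiring semiring) public using () renaming (_×_ to _·ℕ_)

CharacteristicZero : ∀ {c ℓ} → Field c ℓ → Set ℓ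
CharacteristicZero K = ∀ (n : ℕ) → n ·ℕ 1# ≈ 0# → n ≡ 0
  where open Field K
        open FieldOps K

-- Matrices over A_k = {0,...,k} = Fin (suc k), represented as the list
-- of their columns, each column being a list of entries (top to bottom).

Col : ℕ → Set
Col k = List (Fin (suc k))

RawMat : ℕ → Set
RawMat k = List (Col k)

module _ {X : Set} where
  allB : (X → Bool) → List X → Bool
  allB p []       = true
  allB p (x ∷ xs) = p x ∧ allB p xs

  anyB : (X → Bool) → List X → Bool
  anyB p []       = false
  anyB p (x ∷ xs) = if p x then true else anyB p xs

  filterB : (X → Bool) → List X → List X
  filterB p []       = []
  filterB p (x ∷ xs) = if p x then x ∷ filterB p xs else filterB p xs

module _ {k : ℕ} where

  isZero : Fin (suc k) → Bool
  isZero Fin.zero    = true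
  isZero (Fin.suc _) = false

  -- entry i of a column (0 if out of range)
  entry : Col k → ℕ → Fin (suc k)
  entry []       _       = Fin.zero
  entry (x ∷ _)  zero    = x
  entry (_ ∷ xs) (suc i) = entry xs i

  nonzeroCol : Col k → Bool
  nonzeroCol c = anyB (λ x → not (isZero x)) c

  nonzeroRow : RawMat k → ℕ → Bool
  nonzeroRow M i = anyB (λ c → not (isZero (entry c i))) M

  isPacked : RawMat k → Bool
  isPacked M = allB (λ c → length c ≡ᵇ length M) M
             ∧ allB nonzeroCol M
             ∧ allB (nonzeroRow M) (upTo (length M))

  _≟M_ : (M N : RawMat k) → Relation.Nullary.Dec (M ≡ N)
  _≟M_ = ListP.≡-dec (ListP.≡-dec FinP._≟_)

  transposeM : RawMat k → RawMat k
  transposeM M = map (λ i → map (λ c → entry c i) M) (upTo (length M))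

  shuffles : {X : Set} → List X → List X → List (List X)
  shuffles []       ys       = [ ys ]
  shuffles (x ∷ xs) []       = [ x ∷ xs ]
  shuffles (x ∷ xs) (y ∷ ys) =
    map (x ∷_) (shuffles xs (y ∷ ys)) ++ map (y ∷_) (shuffles (x ∷ xs) ys)

  shiftedShuffle : RawMat k → RawMat k → List (RawMat k)
  shiftedShuffle M₁ M₂ =
    shuffles (map (λ c → c ++ replicate n₂ Fin.zero) M₁)
             (map (λ c → replicate n₁ Fin.zero ++ c) M₂)
    where n₁ = length M₁
          n₂ = length M₂

  cp : ℕ → RawMat k → RawMat k
  cp h N = map (λ c → map (entry c) keptRows) (filterB (λ c → nonzeroCol c) N)
    where keptRows = filterB (λ i → nonzeroRow N i) (upTo h)
  
  isSquare : RawMat k → Bool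
  isSquare N = allB (λ c → length c ≡ᵇ length N) N

  decompositions : RawMat k → List (RawMat k × RawMat k)
  decompositions M = concatMap step (upTo (suc (length M)))
    where
      n = length M
      step : ℕ → List (RawMat k × RawMat k)
      step j = if isSquare L ∧ isSquare R then [ (L , R) ] else []
        where L = cp n (take j M)
              R = cp n (drop j M)

module PM {c ℓ} (K : Field c ℓ) (k : ℕ) where
  open Field K

  Basis : Set
  Basis = Σ (RawMat k) (λ M → T (isPacked M))

  raw : Basis → RawMat k
  raw = proj₁

  toBasis : RawMat k → Maybe Basis
  toBasis M with T? (isPacked M)
  ... | yes p = just (M , p)
  ... | no  _ = nothing

  ∅ : Basis
  ∅ = [] , _

  -- elements of PM_k: finite linear combinations Σ c F_M, given as lists of (c , M)
  PMk : Set c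
  PMk = List (Carrier × Basis)

  -- elements of PM_k^⋆ (graded dual): finite linear combinations Σ c F⋆_M
  PMkDual : Set c
  PMkDual = List (Carrier × Basis)

  -- elements of PM_k ⊗ PM_k (resp. PM_k^⋆ ⊗ PM_k^⋆): Σ c F_L ⊗ F_R
  Tensor : Set c
  Tensor = List (Carrier × Basis × Basis)

  coeff : List (Carrier × Basis) → Basis → Carrier
  coeff v M = foldr (λ { (a , N) s → (if does (raw N ≟M raw M) then a else 0#) + s }) 0# v

  coeff₂ : Tensor → Basis → Basis → Carrier
  coeff₂ t A B = foldr (λ { (a , L , R) s →
      (if does (raw L ≟M raw A) ∧ does (raw R ≟M raw B) then a else 0#) + s }) 0# t

  -- vector space operations (addition is concatenation _++_)
  scale : Carrier → List (Carrier × Basis) → List (Carrier × Basis)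
  scale a = map (λ { (b , N) → (a * b , N) })

  basisList : List (RawMat k) → List Basis
  basisList = mapMaybe toBasis

  mul : PMk → PMk → PMk
  mul u v = concatMap (λ { (a , A) → concatMap (λ { (b , B) →
              map (λ N → (a * b , N)) (basisList (shiftedShuffle (raw A) (raw B))) }) v }) u

  one : PMk
  one = [ (1# , ∅) ]

  basisPairs : List (RawMat k × RawMat k) → List (Basis × Basis)
  basisPairs = mapMaybe (λ { (L , R) → pairUp (toBasis L) (toBasis R) })
    where pairUp : Maybe Basis → Maybe Basis → Maybe (Basis × Basis)
          pairUp (just x) (just y) = just (x , y)
          pairUp _ _ = nothing

  Δ : PMk → Tensor
  Δ u = concatMap (λ { (a , M) → map (λ { (L , R) → (a , L , R) })
                                     (basisPairs (decompositions (raw M))) }) u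

  ε : PMk → Carrier
  ε u = coeff u ∅

  -- A dual element
  -- f is determined by its values ⟨f , F_M⟩ on the basis; dual elements
  -- (and elements of the dual tensor square) are compared through these.

  Functional : Set c
  Functional = Basis → Carrier

  Functional₂ : Set c
  Functional₂ = Basis → Basis → Carrier

  ⟦_⟧ : PMkDual → Functional
  ⟦ f ⟧ = coeff f

  ⟦_⟧₂ : Tensor → Functional₂
  ⟦ t ⟧₂ = coeff₂ t

  pair : Functional → PMk → Carrier
  pair f u = foldr (λ { (a , N) s → a * f N + s }) 0# u

  pair₂ : Functional₂ → Tensor → Carrier
  pair₂ g t = foldr (λ { (a , L , R) s → a * g L R + s }) 0# t

  _·⋆_ : Functional → Functional → Functional
  (f ·⋆ g) M = pair₂ (λ L R → f L * g R) (Δ [ (1# , M) ])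

  one⋆ : Functional
  one⋆ M = ε [ (1# , M) ]

  Δ⋆ : Functional → Functional₂
  Δ⋆ f A B = pair f (mul [ (1# , A) ] [ (1# , B) ])

  ε⋆ : Functional → Carrier
  ε⋆ f = pair f one

  -- φ (F_M) = F⋆_{Mᵀ}, extended linearly (Mᵀ is again k-packed, so the
  -- mapMaybe never drops a term)

  transposeB : Basis → Maybe Basis
  transposeB M = toBasis (transposeM (raw M))

  φ : PMk → PMkDual
  φ = mapMaybe (λ { (a , M) → Data.Maybe.map (a ,_) (transposeB M) })

  φ⊗φ : Tensor → Tensor
  φ⊗φ = mapMaybe (λ { (a , L , R) → both a (transposeB L) (transposeB R) })
    where both : Carrier → Maybe Basis → Maybe Basis → Maybe (Carrier × Basis × Basis)
          both a (just x) (just y) = just (a , x , y)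
          both _ _ _ = nothing

  -- φ is an isomorphism of Hopf algebras PM_k → PM_k^⋆
  -- (a bijective linear map which is a morphism of algebras and of
  -- coalgebras; compatibility with antipodes is then automatic).
  record PhiIsHopfIsomorphism : Set (c ⊔ ℓ) where
    field
      φ-additive : ∀ (u v : PMk) M → ⟦ φ (u ++ v) ⟧ M ≈ ⟦ φ u ⟧ M + ⟦ φ v ⟧ M
      φ-homogeneous : ∀ (a : Carrier) (u : PMk) M → ⟦ φ (scale a u) ⟧ M ≈ a * ⟦ φ u ⟧ M
      φ-injective : ∀ (u v : PMk) → (∀ M → ⟦ φ u ⟧ M ≈ ⟦ φ v ⟧ M) → ∀ M → coeff u M ≈ coeff v M
      φ-surjective : ∀ (f : PMkDual) → Σ PMk (λ u → ∀ M → ⟦ φ u ⟧ M ≈ ⟦ f ⟧ M)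
      φ-mul : ∀ (u v : PMk) M → ⟦ φ (mul u v) ⟧ M ≈ (⟦ φ u ⟧ ·⋆ ⟦ φ v ⟧) M
      φ-one : ∀ M → ⟦ φ one ⟧ M ≈ one⋆ M
      φ-Δ : ∀ (u : PMk) A B → Δ⋆ ⟦ φ u ⟧ A B ≈ ⟦ φ⊗φ (Δ u) ⟧₂ A B
      φ-ε : ∀ (u : PMk) → ε⋆ ⟦ φ u ⟧ ≈ ε u

module Submission where

-- φ is multiplicative and comultiplicative because transposition exchanges the structure
-- constants of the product and of the coproduct: the coefficient of F_{Mᵀ} in F_A · F_B equals
-- that of F_{Aᵀ} ⊗ F_{Bᵀ} in Δ F_M, and both are 0 or 1. Read Mᵀ column by column, i.e. M row
-- by row, and let a be the size of A. Then Mᵀ is a shifted shuffle of A and B exactly when the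
-- rows of M with a nonzero entry among their first a entries are the columns of A padded with
-- zeros below, and the other rows are the columns of B padded with zeros above. Compressing the
-- two column blocks of M cut after column a, this says precisely that M = L • R with
-- cp L = Aᵀ and cp R = Bᵀ, and no other cut yields blocks of these sizes. Linearity,
-- bijectivity, unit and counit only use that transposition is an involution on packed matrices.

open import Defs
open import Data.Nat using (ℕ; _≤_)
open import Algebra.Bundles using (CommutativeRing)
open import Data.Bool using (Bool; true; false; not; _∧_; _∨_; T; if_then_else_)
import Data.Fin as Fin
open import Data.List
  using ( List; []; _∷_; [_]; _++_; _∷ʳ_; map; length; take; drop; concatMap; foldr; mapMaybe
        ; upTo; applyUpTo; replicate)
import Data.List.Properties as List
open import Data.List.Membership.Propositional using (_∈_)
open import Data.Maybe using (Maybe; just; nothing; maybe)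
open import Data.Product using (Σ; _×_; _,_; ∃; proj₁; proj₂; map₁)
open import Function using (_∘_; _⇔_; mk⇔; Equivalence)
open import Relation.Nullary using (Dec; yes; no; does; contradiction)
import Relation.Binary.PropositionalEquality as ≡
open ≡ using (_≡_)

module Combinatorics where

  open import Data.Nat using (zero; suc; _+_; _∸_; _<_; z≤n; s≤s; _⊓_; _≟_; _≡ᵇ_)
  open import Data.Nat.Properties
    using ( +-suc; +-identityʳ; +-assoc; ≤-trans; m≤m+n; m≤n⇒m⊓n≡m; m⊓n≡m⇒m≤n; m+n∸m≡n; ≤-pred; n≤1+n
          ; +-monoʳ-≤; ≤-reflexive; 1+n≰n; suc-injective; n<1+n; <-irrefl; ≤∧≢⇒<; m<n⇒m<1+n; ≡ᵇ⇒≡; ≡⇒≡ᵇ)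
  open import Data.Bool.Properties using (¬-not; ∧-zeroʳ; ∧-conicalˡ; ∧-conicalʳ; T-≡; not-injective)
  open import Data.List.Membership.Propositional.Properties using (∈-upTo⁻; ∈-map⁻; ∈-map⁺; ∈-upTo⁺)
  import Data.List.Relation.Unary.All as All
  open import Data.List.Relation.Unary.Any using (here; there)
  open import Relation.Nullary.Decidable using (_×-dec_; dec-true; dec-false; does-⇔)
  open import Relation.Binary.Definitions using (DecidableEquality)
  open import Relation.Binary.PropositionalEquality
    using (_≡_; refl; sym; trans; cong; cong₂; subst; module ≡-Reasoning)

  does⇒ : ∀ {P : Set} (d : Dec P) → does d ≡ true → P
  does⇒ (yes p) _ = p

  module _ {X : Set} where

    take-length-++ : ∀ (xs ys : List X) → take (length xs) (xs ++ ys) ≡ xs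
    take-length-++ []       ys = refl
    take-length-++ (x ∷ xs) ys = cong (x ∷_) (take-length-++ xs ys)

    drop-length-++ : ∀ (xs ys : List X) → drop (length xs) (xs ++ ys) ≡ ys
    drop-length-++ []       ys = refl
    drop-length-++ (x ∷ xs) ys = drop-length-++ xs ys

    ∈-take⁻ : ∀ n {xs : List X} {x} → x ∈ take n xs → x ∈ xs
    ∈-take⁻ (suc n) {_ ∷ _} (here refl) = here refl
    ∈-take⁻ (suc n) {_ ∷ _} (there x∈)  = there (∈-take⁻ n x∈)

    ∈-drop⁻ : ∀ n {xs : List X} {x} → x ∈ drop n xs → x ∈ xs
    ∈-drop⁻ zero              x∈ = x∈
    ∈-drop⁻ (suc n) {_ ∷ _} x∈ = there (∈-drop⁻ n x∈)

    block-lengths⇔ : ∀ a b (xs : List X) →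
                     (length (take a xs) ≡ a × length (drop a xs) ≡ b) ⇔ a + b ≡ length xs
    block-lengths⇔ a b xs = mk⇔ ⇒ ⇐
      where
      ⇒ : length (take a xs) ≡ a × length (drop a xs) ≡ b → a + b ≡ length xs
      ⇒ (l , r) = trans (cong₂ _+_ (sym l) (sym r))
                        (trans (sym (List.length-++ (take a xs))) (cong length (List.take++drop≡id a xs)))
      ⇐ : a + b ≡ length xs → length (take a xs) ≡ a × length (drop a xs) ≡ b
      ⇐ width = trans (List.length-take a xs) (m≤n⇒m⊓n≡m (subst (a ≤_) width (m≤m+n a b)))
              , trans (List.length-drop a xs) (trans (cong (_∸ a) (sym width)) (m+n∸m≡n a b))

  module _ {X : Set} {p : X → Bool} where

    allB⁻ : ∀ {xs x} → allB p xs ≡ true → x ∈ xs → p x ≡ true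
    allB⁻ h (here refl) = ∧-conicalˡ _ _ h
    allB⁻ h (there x∈)  = allB⁻ (∧-conicalʳ _ _ h) x∈

    allB⁺ : ∀ xs → (∀ {x} → x ∈ xs → p x ≡ true) → allB p xs ≡ true
    allB⁺ []       _ = refl
    allB⁺ (x ∷ xs) h rewrite h (here refl) = allB⁺ xs (h ∘ there)

    anyB⁺ : ∀ {xs x} → x ∈ xs → p x ≡ true → anyB p xs ≡ true
    anyB⁺ (here refl) px rewrite px = refl
    anyB⁺ {y ∷ _} (there x∈) px with p y
    ... | true  = refl
    ... | false = anyB⁺ x∈ px

    filterB-∈⁻ : ∀ {xs x} → x ∈ filterB p xs → x ∈ xs × p x ≡ true
    filterB-∈⁻ {y ∷ xs} x∈ with p y in py
    filterB-∈⁻ {y ∷ xs} (here refl) | true  = here refl , py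
    filterB-∈⁻ {y ∷ xs} (there x∈)  | true  = map₁ there (filterB-∈⁻ x∈)
    filterB-∈⁻ {y ∷ xs} x∈          | false = map₁ there (filterB-∈⁻ x∈)

    filterB-∈⁺ : ∀ {xs x} → x ∈ xs → p x ≡ true → x ∈ filterB p xs
    filterB-∈⁺ (here refl) px rewrite px = here refl
    filterB-∈⁺ {y ∷ _} (there x∈) px with p y
    ... | true  = there (filterB-∈⁺ x∈ px)
    ... | false = filterB-∈⁺ x∈ px

    filterB-all : ∀ xs → (∀ {x} → x ∈ xs → p x ≡ true) → filterB p xs ≡ xs
    filterB-all []       _ = refl
    filterB-all (x ∷ xs) h rewrite h (here refl) = cong (x ∷_) (filterB-all xs (h ∘ there))

    filterB-none : ∀ xs → (∀ {x} → x ∈ xs → p x ≡ false) → filterB p xs ≡ []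
    filterB-none []       _ = refl
    filterB-none (x ∷ xs) h rewrite h (here refl) = filterB-none xs (h ∘ there)

    filterB≡[]⇒filterB-not≡id : ∀ xs → filterB p xs ≡ [] → filterB (not ∘ p) xs ≡ xs
    filterB≡[]⇒filterB-not≡id []       _ = refl
    filterB≡[]⇒filterB-not≡id (x ∷ xs) h with p x
    ... | false = cong (x ∷_) (filterB≡[]⇒filterB-not≡id xs h)

    filterB-not≡[]⇒filterB≡id : ∀ xs → filterB (not ∘ p) xs ≡ [] → filterB p xs ≡ xs
    filterB-not≡[]⇒filterB≡id []       _ = refl
    filterB-not≡[]⇒filterB≡id (x ∷ xs) h with p x
    ... | true = cong (x ∷_) (filterB-not≡[]⇒filterB≡id xs h)

    length-filterB-not : ∀ xs → length (filterB p xs) + length (filterB (not ∘ p) xs) ≡ length xs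
    length-filterB-not []       = refl
    length-filterB-not (x ∷ xs) with p x
    ... | true  = cong suc (length-filterB-not xs)
    ... | false = trans (+-suc _ _) (cong suc (length-filterB-not xs))

  module _ {X : Set} {p q : X → Bool} where

    filterB-cong : ∀ xs → (∀ {x} → x ∈ xs → p x ≡ q x) → filterB p xs ≡ filterB q xs
    filterB-cong []       _ = refl
    filterB-cong (x ∷ xs) h rewrite h (here refl) with q x
    ... | true  = cong (x ∷_) (filterB-cong xs (h ∘ there))
    ... | false = filterB-cong xs (h ∘ there)

    length-filterB-cover : ∀ xs → (∀ {x} → x ∈ xs → p x ∨ q x ≡ true) →
                           length xs ≤ length (filterB p xs) + length (filterB q xs)
    length-filterB-cover []       _ = z≤n
    length-filterB-cover (x ∷ xs) h with p x | q x | h (here refl) | length-filterB-cover xs (h ∘ there)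
    ... | true  | true  | _ | ih = s≤s (≤-trans ih (+-monoʳ-≤ _ (n≤1+n _)))
    ... | true  | false | _ | ih = s≤s ih
    ... | false | true  | _ | ih = ≤-trans (s≤s ih) (≤-reflexive (sym (+-suc _ _)))

    exact-cover⇒complement : ∀ xs → (∀ {x} → x ∈ xs → p x ∨ q x ≡ true) →
                             length (filterB p xs) + length (filterB q xs) ≡ length xs →
                             ∀ {x} → x ∈ xs → q x ≡ not (p x)
    exact-cover⇒complement (y ∷ ys) h e x∈ with p y in py | q y in qy | h (here refl) | x∈
    ... | true  | true  | _ | _ = contradiction (≤-trans (≤-reflexive (trans (sym (+-suc _ _)) (suc-injective e)))
                                                       (length-filterB-cover ys (h ∘ there))) 1+n≰n
    ... | true  | false | _ | here refl = trans qy (cong not (sym py))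
    ... | true  | false | _ | there x∈′ = exact-cover⇒complement ys (h ∘ there) (suc-injective e) x∈′
    ... | false | true  | _ | here refl = trans qy (cong not (sym py))
    ... | false | true  | _ | there x∈′ =
      exact-cover⇒complement ys (h ∘ there) (suc-injective (trans (sym (+-suc _ _)) e)) x∈′

  module _ {X Y : Set} (p : Y → Bool) (f : X → Y) where

    anyB-map : ∀ xs → anyB p (map f xs) ≡ anyB (p ∘ f) xs
    anyB-map []       = refl
    anyB-map (x ∷ xs) rewrite anyB-map xs = refl

    filterB-map : ∀ xs → filterB p (map f xs) ≡ map f (filterB (p ∘ f) xs)
    filterB-map []       = refl
    filterB-map (x ∷ xs) with p (f x)
    ... | true  = cong (f x ∷_) (filterB-map xs)
    ... | false = filterB-map xs

  indicator : Bool → ℕ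
  indicator b = if b then 1 else 0

  count : {X : Set} → (X → Bool) → List X → ℕ
  count p []       = 0
  count p (x ∷ xs) = indicator (p x) + count p xs

  module _ {X : Set} where

    count-++ : ∀ (p : X → Bool) xs ys → count p (xs ++ ys) ≡ count p xs + count p ys
    count-++ p []       ys = refl
    count-++ p (x ∷ xs) ys =
      trans (cong (indicator (p x) +_) (count-++ p xs ys)) (sym (+-assoc (indicator (p x)) _ _))

    count-cong : ∀ {p q : X → Bool} xs → (∀ {x} → x ∈ xs → p x ≡ q x) → count p xs ≡ count q xs
    count-cong []       _ = refl
    count-cong (x ∷ xs) h = cong₂ _+_ (cong indicator (h (here refl))) (count-cong xs (h ∘ there))

    count-none : ∀ {p : X → Bool} xs → (∀ {x} → x ∈ xs → p x ≡ false) → count p xs ≡ 0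
    count-none []       _ = refl
    count-none (x ∷ xs) h rewrite h (here refl) = count-none xs (h ∘ there)

    count-∧ˡ : ∀ b (p : X → Bool) xs → count (λ x → b ∧ p x) xs ≡ (if b then count p xs else 0)
    count-∧ˡ true  p xs = refl
    count-∧ˡ false p xs = count-none xs λ _ → refl

    count-if-singleton : ∀ (p : X → Bool) b x → (p x ≡ true → b ≡ true) →
                         count p (if b then [ x ] else []) ≡ indicator (p x)
    count-if-singleton p true  x _ = +-identityʳ _
    count-if-singleton p false x h with p x
    ... | true  = contradiction (h refl) λ ()
    ... | false = refl

  module _ {X Y : Set} where

    count-map : ∀ (p : Y → Bool) (f : X → Y) xs → count p (map f xs) ≡ count (p ∘ f) xs
    count-map p f []       = refl
    count-map p f (x ∷ xs) = cong (indicator (p (f x)) +_) (count-map p f xs)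

    count-mapMaybe : ∀ (p : Y → Bool) (f : X → Maybe Y) xs →
                     count p (mapMaybe f xs) ≡ count (maybe p false ∘ f) xs
    count-mapMaybe p f []       = refl
    count-mapMaybe p f (x ∷ xs) with f x
    ... | just y  = cong (indicator (p y) +_) (count-mapMaybe p f xs)
    ... | nothing = count-mapMaybe p f xs

    count-concatMap : ∀ (p : Y → Bool) (q : X → Bool) (f : X → List Y) xs →
                      (∀ x → count p (f x) ≡ indicator (q x)) → count p (concatMap f xs) ≡ count q xs
    count-concatMap p q f []       h = refl
    count-concatMap p q f (x ∷ xs) h =
      trans (count-++ p (f x) (concatMap f xs)) (cong₂ _+_ (h x) (count-concatMap p q f xs h))

  count-upTo-unique : ∀ (q : ℕ → Bool) a m → (∀ j → j < m → q j ≡ true → j ≡ a) → (q a ≡ true → a < m) →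
                      count q (upTo m) ≡ indicator (q a)
  count-upTo-unique q a zero    _    bound with q a
  ... | true  = contradiction (bound refl) λ ()
  ... | false = refl
  count-upTo-unique q a (suc m) uniq bound = begin
    count q (upTo (suc m))                  ≡⟨ cong (count q) (List.upTo-∷ʳ m) ⟨
    count q (upTo m ∷ʳ m)                   ≡⟨ count-++ q (upTo m) [ m ] ⟩
    count q (upTo m) + (indicator (q m) + 0) ≡⟨ last (m ≟ a) ⟩
    indicator (q a)                          ∎
    where
    open ≡-Reasoning
    last : Dec (m ≡ a) → count q (upTo m) + (indicator (q m) + 0) ≡ indicator (q a)
    last (yes refl) = cong₂ _+_ (count-none (upTo m) λ j∈ → ¬-not λ qj →
                        <-irrefl (uniq _ (≤-trans (∈-upTo⁻ j∈) (n≤1+n m)) qj) (∈-upTo⁻ j∈)) (+-identityʳ _)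
    last (no m≢a) rewrite ¬-not {q m} λ qm → m≢a (uniq m (n<1+n m) qm) = trans (+-identityʳ _)
      (count-upTo-unique q a m (λ j j<m → uniq j (m<n⇒m<1+n j<m))
                               (λ qa → ≤∧≢⇒< (≤-pred (bound qa)) (m≢a ∘ sym)))

  -- Shuffles

  module _ {X : Set} (_≟_ : DecidableEquality X) (p : X → Bool) where

    _≟ₗ_ : DecidableEquality (List X)
    _≟ₗ_ = List.≡-dec _≟_

    splits? : (zs xs ys : List X) → Dec (filterB p zs ≡ xs × filterB (not ∘ p) zs ≡ ys)
    splits? zs xs ys = (filterB p zs ≟ₗ xs) ×-dec (filterB (not ∘ p) zs ≟ₗ ys)

    private
      count-∷≡[] : ∀ x S → count (λ ws → does (ws ≟ₗ [])) (map (x ∷_) S) ≡ 0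
      count-∷≡[] x S = trans (count-map _ (x ∷_) S) (count-none S λ _ → refl)

      count-∷≡∷ : ∀ x z zs S → count (λ ws → does (ws ≟ₗ (z ∷ zs))) (map (x ∷_) S) ≡
                               (if does (x ≟ z) then count (λ ws → does (ws ≟ₗ zs)) S else 0)
      count-∷≡∷ x z zs S = trans (count-map _ (x ∷_) S) (count-∧ˡ (does (x ≟ z)) _ S)

    -- The implicit k is the matrix alphabet that Defs.shuffles carries without using it.
    count-shuffles : ∀ {k} xs ys zs → (∀ {x} → x ∈ xs → p x ≡ true) → (∀ {y} → y ∈ ys → p y ≡ false) →
      count (λ ws → does (ws ≟ₗ zs)) (shuffles {k} xs ys) ≡ indicator (does (splits? zs xs ys))
    count-shuffles [] ys zs _ ys∉ =
      trans (+-identityʳ _) (cong indicator (does-⇔ (mk⇔ ⇒ ⇐) (ys ≟ₗ zs) (splits? zs [] ys)))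
      where
      ⇒ : ys ≡ zs → filterB p zs ≡ [] × filterB (not ∘ p) zs ≡ ys
      ⇒ refl = filterB-none ys ys∉ , filterB-all ys (cong not ∘ ys∉)
      ⇐ : filterB p zs ≡ [] × filterB (not ∘ p) zs ≡ ys → ys ≡ zs
      ⇐ (l , r) = trans (sym r) (filterB≡[]⇒filterB-not≡id zs l)
    count-shuffles (x ∷ xs) [] zs xs∈ _ =
      trans (+-identityʳ _) (cong indicator (does-⇔ (mk⇔ ⇒ ⇐) ((x ∷ xs) ≟ₗ zs) (splits? zs (x ∷ xs) [])))
      where
      ⇒ : x ∷ xs ≡ zs → filterB p zs ≡ x ∷ xs × filterB (not ∘ p) zs ≡ []
      ⇒ refl = filterB-all (x ∷ xs) xs∈ , filterB-none (x ∷ xs) (cong not ∘ xs∈)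
      ⇐ : filterB p zs ≡ x ∷ xs × filterB (not ∘ p) zs ≡ [] → x ∷ xs ≡ zs
      ⇐ (l , r) = trans (sym l) (filterB-not≡[]⇒filterB≡id zs r)
    count-shuffles {k} (x ∷ xs) (y ∷ ys) [] _ _ =
      trans (count-++ _ (map (x ∷_) (shuffles {k} xs (y ∷ ys))) _)
            (cong₂ _+_ (count-∷≡[] x (shuffles {k} xs (y ∷ ys))) (count-∷≡[] y (shuffles {k} (x ∷ xs) ys)))
    count-shuffles {k} (x ∷ xs) (y ∷ ys) (z ∷ zs) xs∈ ys∉
      rewrite count-++ (λ ws → does (ws ≟ₗ (z ∷ zs))) (map (x ∷_) (shuffles {k} xs (y ∷ ys)))
                                                      (map (y ∷_) (shuffles {k} (x ∷ xs) ys))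
            | count-∷≡∷ x z zs (shuffles {k} xs (y ∷ ys))
            | count-∷≡∷ y z zs (shuffles {k} (x ∷ xs) ys)
      with p z in pz | x ≟ z | y ≟ z
    ... | true  | _        | yes refl = contradiction (trans (sym pz) (ys∉ (here refl))) λ ()
    ... | false | yes refl | _        = contradiction (trans (sym (xs∈ (here refl))) pz) λ ()
    ... | true  | yes refl | no _     rewrite dec-true (x ≟ x) refl =
      trans (+-identityʳ _) (count-shuffles {k} xs (y ∷ ys) zs (xs∈ ∘ there) ys∉)
    ... | true  | no x≢z   | no _     rewrite dec-false (z ≟ x) (x≢z ∘ sym) = refl
    ... | false | no _     | yes refl rewrite dec-true (y ≟ y) refl =
      count-shuffles {k} (x ∷ xs) ys zs xs∈ (ys∉ ∘ there)
    ... | false | no _     | no y≢z   rewrite dec-false (z ≟ y) (y≢z ∘ sym) =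
      cong indicator (sym (∧-zeroʳ _))

  -- Matrices, transposition and compression

  module _ {k : ℕ} where

    column : RawMat k → ℕ → Col k
    column []      _       = []
    column (c ∷ _) zero    = c
    column (_ ∷ M) (suc j) = column M j

    row : RawMat k → ℕ → Col k
    row M i = map (λ c → entry c i) M

    -- transposeM M unfolds to rows (length M) M.
    rows : ℕ → RawMat k → RawMat k
    rows h M = map (row M) (upTo h)

    column-∈ : ∀ M {j} → j < length M → column M j ∈ M
    column-∈ (c ∷ M) {zero}  _         = here refl
    column-∈ (c ∷ M) {suc j} (s≤s j<n) = there (column-∈ M j<n)

    entry-row : ∀ M i j → entry (row M i) j ≡ entry (column M j) i
    entry-row []      i j       = refl
    entry-row (c ∷ M) i zero    = refl
    entry-row (c ∷ M) i (suc j) = entry-row M i j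

    length-rows : ∀ h M → length (rows h M) ≡ h
    length-rows h M = trans (List.length-map (row M) (upTo h)) (List.length-upTo h)

    ∈-rows⁻ : ∀ {h M r} → r ∈ rows h M → ∃ λ i → i < h × r ≡ row M i
    ∈-rows⁻ {M = M} r∈ with ∈-map⁻ (row M) r∈
    ... | i , i∈ , refl = i , ∈-upTo⁻ i∈ , refl

    applyUpTo-entry : ∀ (c : Col k) → applyUpTo (entry c) (length c) ≡ c
    applyUpTo-entry []      = refl
    applyUpTo-entry (x ∷ c) = cong (x ∷_) (applyUpTo-entry c)

    applyUpTo-column : ∀ M → applyUpTo (column M) (length M) ≡ M
    applyUpTo-column []      = refl
    applyUpTo-column (c ∷ M) = cong (c ∷_) (applyUpTo-column M)

    rows-map-row : ∀ K X → rows (length X) (map (row X) K) ≡ map (λ c → map (entry c) K) X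
    rows-map-row K X = begin
      map (row (map (row X) K)) (upTo (length X))      ≡⟨ List.map-cong row-selection (upTo (length X)) ⟩
      map (restrict ∘ column X) (upTo (length X))      ≡⟨ List.map-∘ (upTo (length X)) ⟩
      map restrict (map (column X) (upTo (length X)))  ≡⟨ cong (map restrict) (List.map-upTo _ (length X)) ⟩
      map restrict (applyUpTo (column X) (length X))   ≡⟨ cong (map restrict) (applyUpTo-column X) ⟩
      map restrict X                                   ∎
      where
      open ≡-Reasoning
      restrict : Col k → Col k
      restrict c = map (entry c) K
      row-selection : ∀ j → row (map (row X) K) j ≡ restrict (column X j)
      row-selection j = trans (sym (List.map-∘ K)) (List.map-cong (λ i → entry-row X i j) K)

    rows-involutive : ∀ h M → (∀ {c} → c ∈ M → length c ≡ h) → rows (length M) (rows h M) ≡ M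
    rows-involutive h M len = trans (rows-map-row (upTo h) M) (List.map-id-local (All.tabulate λ {c} c∈ →
      trans (List.map-upTo (entry c) h) (subst (λ m → applyUpTo (entry c) m ≡ c) (len c∈) (applyUpTo-entry c))))

    record Packed (M : RawMat k) : Set where
      field
        column-length  : ∀ {c} → c ∈ M → length c ≡ length M
        column-nonzero : ∀ {c} → c ∈ M → nonzeroCol c ≡ true
        row-nonzero    : ∀ {i} → i < length M → nonzeroRow M i ≡ true
    open Packed public

    T⇒Packed : ∀ M → T (isPacked M) → Packed M
    T⇒Packed M t = record
      { column-length  = λ c∈ → ≡ᵇ⇒≡ _ _ (Equivalence.from T-≡ (allB⁻ (∧-conicalˡ _ _ packed) c∈))
      ; column-nonzero = allB⁻ (∧-conicalˡ (allB nonzeroCol M) _ columns-and-rows)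
      ; row-nonzero    = λ i< → allB⁻ (∧-conicalʳ (allB nonzeroCol M) _ columns-and-rows) (∈-upTo⁺ i<)
      }
      where
      packed : isPacked M ≡ true
      packed = Equivalence.to T-≡ t
      columns-and-rows : allB nonzeroCol M ∧ allB (nonzeroRow M) (upTo (length M)) ≡ true
      columns-and-rows = ∧-conicalʳ (allB (λ c → length c ≡ᵇ length M) M) _ packed

    Packed⇒T : ∀ M → Packed M → T (isPacked M)
    Packed⇒T M P = Equivalence.from T-≡ (cong₂ _∧_
      (allB⁺ M λ c∈ → Equivalence.to T-≡ (≡⇒≡ᵇ _ _ (column-length P c∈)))
      (cong₂ _∧_ (allB⁺ M (column-nonzero P)) (allB⁺ (upTo (length M)) (row-nonzero P ∘ ∈-upTo⁻))))

    transpose-involutive : ∀ {M} → Packed M → transposeM (transposeM M) ≡ M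
    transpose-involutive {M} P = trans (cong (λ m → rows m (transposeM M)) (length-rows (length M) M))
                                       (rows-involutive (length M) M (column-length P))

    Packed⇒isSquare : ∀ {M} → Packed M → isSquare M ≡ true
    Packed⇒isSquare {M} P = allB⁺ M λ c∈ → Equivalence.to T-≡ (≡⇒≡ᵇ _ _ (column-length P c∈))

    nonzeroRow-row : ∀ M i → nonzeroRow M i ≡ nonzeroCol (row M i)
    nonzeroRow-row M i = sym (anyB-map (λ x → not (isZero x)) (λ c → entry c i) M)

    nonzeroCol⇒nonzero-entry : ∀ (c : Col k) → nonzeroCol c ≡ true →
                               ∃ λ i → i < length c × not (isZero (entry c i)) ≡ true
    nonzeroCol⇒nonzero-entry (Fin.zero  ∷ c) nz with nonzeroCol⇒nonzero-entry c nz
    ... | i , i< , e = suc i , s≤s i< , e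
    nonzeroCol⇒nonzero-entry (Fin.suc _ ∷ c) _ = 0 , s≤s z≤n , refl

    transpose-Packed : ∀ M → Packed M → Packed (transposeM M)
    transpose-Packed M P = record
      { column-length  = λ r∈ → let i , _ , r≡ = ∈-rows⁻ r∈ in
          trans (cong length r≡) (trans (List.length-map _ M) (sym (length-rows n M)))
      ; column-nonzero = λ r∈ → let i , i< , r≡ = ∈-rows⁻ r∈ in
          trans (cong nonzeroCol r≡) (trans (sym (nonzeroRow-row M i)) (row-nonzero P i<))
      ; row-nonzero    = λ j< → nonzero-row (subst (_ <_) (length-rows n M) j<)
      }
      where
      n = length M
      nonzero-row : ∀ {j} → j < n → nonzeroRow (transposeM M) j ≡ true
      nonzero-row {j} j< with nonzeroCol⇒nonzero-entry (column M j) (column-nonzero P (column-∈ M j<))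
      ... | i , i< , e = anyB⁺ (∈-map⁺ (row M) (∈-upTo⁺ (subst (i <_) (column-length P (column-∈ M j<)) i<)))
                               (trans (cong (not ∘ isZero) (entry-row M i j)) e)

    NonzeroColumns : ℕ → RawMat k → Set
    NonzeroColumns h Y = ∀ {c} → c ∈ Y → length c ≡ h × nonzeroCol c ≡ true

    Packed⇒NonzeroColumns : ∀ {M} → Packed M → NonzeroColumns (length M) M
    Packed⇒NonzeroColumns P c∈ = column-length P c∈ , column-nonzero P c∈

    NonzeroColumns-0 : ∀ Y → NonzeroColumns 0 Y → Y ≡ []
    NonzeroColumns-0 []            _ = refl
    NonzeroColumns-0 ([] ∷ _)      h = contradiction (proj₂ (h (here refl))) λ ()
    NonzeroColumns-0 ((_ ∷ _) ∷ _) h = contradiction (proj₁ (h (here refl))) λ ()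

    -- For h = 0 the rows carry no information, which is why zero columns must be excluded.
    rows-injective : ∀ h {Y Z} → NonzeroColumns h Y → NonzeroColumns h Z → rows h Y ≡ rows h Z → Y ≡ Z
    rows-injective zero    {Y} {Z} hY hZ _ = trans (NonzeroColumns-0 Y hY) (sym (NonzeroColumns-0 Z hZ))
    rows-injective (suc h) {Y} {Z} hY hZ e = begin
      Y                                ≡⟨ rows-involutive (suc h) Y (proj₁ ∘ hY) ⟨
      rows (length Y) (rows (suc h) Y) ≡⟨ cong₂ rows same-width e ⟩
      rows (length Z) (rows (suc h) Z) ≡⟨ rows-involutive (suc h) Z (proj₁ ∘ hZ) ⟩
      Z                                ∎
      where
      open ≡-Reasoning
      same-width : length Y ≡ length Z
      same-width = trans (sym (List.length-map _ Y))
                         (trans (cong length (List.∷-injectiveˡ e)) (List.length-map _ Z))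

    cp-nonzero-columns : ∀ h X → (∀ {c} → c ∈ X → nonzeroCol c ≡ true) →
                         cp h X ≡ rows (length X) (filterB nonzeroCol (rows h X))
    cp-nonzero-columns h X nz = begin
      cp h X                                          ≡⟨ cong (map restrict) (filterB-all X nz) ⟩
      map restrict X                                  ≡⟨ rows-map-row K X ⟨
      rows (length X) (map (row X) K)                 ≡⟨ cong (rows (length X)) nonzero-rows ⟨
      rows (length X) (filterB nonzeroCol (rows h X)) ∎
      where
      open ≡-Reasoning
      K : List ℕ
      K = filterB (nonzeroRow X) (upTo h)
      restrict : Col k → Col k
      restrict c = map (entry c) K
      nonzero-rows : filterB nonzeroCol (rows h X) ≡ map (row X) K
      nonzero-rows = trans (filterB-map nonzeroCol (row X) (upTo h))
                           (cong (map (row X)) (filterB-cong (upTo h) λ {i} _ → sym (nonzeroRow-row X i)))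

    cp≡transpose⇔ : ∀ h X C → (∀ {c} → c ∈ X → nonzeroCol c ≡ true) → Packed C →
                    cp h X ≡ transposeM C ⇔ (length X ≡ length C × filterB nonzeroCol (rows h X) ≡ C)
    cp≡transpose⇔ h X C nz P = mk⇔ ⇒ ⇐
      where
      Y = filterB nonzeroCol (rows h X)
      ⇒ : cp h X ≡ transposeM C → length X ≡ length C × Y ≡ C
      ⇒ e = same-width , rows-injective (length C) Y-columns (Packed⇒NonzeroColumns P)
                           (trans (cong (λ m → rows m Y) (sym same-width)) e′)
        where
        e′ : rows (length X) Y ≡ transposeM C
        e′ = trans (sym (cp-nonzero-columns h X nz)) e
        same-width : length X ≡ length C
        same-width = trans (sym (length-rows _ Y)) (trans (cong length e′) (length-rows _ C))
        Y-columns : NonzeroColumns (length C) Y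
        Y-columns r∈ with filterB-∈⁻ {p = nonzeroCol} {xs = rows h X} r∈
        ... | r∈′ , nz′ with ∈-rows⁻ {M = X} r∈′
        ... | i , _ , refl = trans (List.length-map _ X) same-width , nz′
      ⇐ : length X ≡ length C × Y ≡ C → cp h X ≡ transposeM C
      ⇐ (l , e) = trans (cp-nonzero-columns h X nz) (cong₂ rows l e)

    -- Cutting the rows of a matrix after column a

    zeros : ℕ → Col k
    zeros m = replicate m Fin.zero

    nonzeroCol-++ : ∀ (c d : Col k) → nonzeroCol (c ++ d) ≡ nonzeroCol c ∨ nonzeroCol d
    nonzeroCol-++ []              d = refl
    nonzeroCol-++ (Fin.zero  ∷ c) d = nonzeroCol-++ c d
    nonzeroCol-++ (Fin.suc _ ∷ c) d = refl

    nonzeroCol-zeros : ∀ m → nonzeroCol (zeros m) ≡ false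
    nonzeroCol-zeros zero    = refl
    nonzeroCol-zeros (suc m) = nonzeroCol-zeros m

    ¬nonzeroCol⇒zeros : ∀ (c : Col k) → nonzeroCol c ≡ false → c ≡ zeros (length c)
    ¬nonzeroCol⇒zeros []             _ = refl
    ¬nonzeroCol⇒zeros (Fin.zero ∷ c) z = cong (Fin.zero ∷_) (¬nonzeroCol⇒zeros c z)

    nonzero-before nonzero-after : ℕ → Col k → Bool
    nonzero-before a r = nonzeroCol (take a r)
    nonzero-after  a r = nonzeroCol (drop a r)

    module RowSplitting {A B R : RawMat k} (PA : Packed A) (PB : Packed B) (PR : Packed R) where

      a b n : ℕ
      a = length A
      b = length B
      n = length R

      F G G′ Ā B̄ : RawMat k
      F  = filterB (nonzero-before a) R
      G  = filterB (not ∘ nonzero-before a) R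
      G′ = filterB (nonzero-after a) R
      Ā  = map (λ c → c ++ zeros b) A
      B̄  = map (λ c → zeros a ++ c) B

      take-Ā : ∀ {c} → c ∈ A → take a (c ++ zeros b) ≡ c
      take-Ā {c} c∈ =
        subst (λ m → take m (c ++ zeros b) ≡ c) (column-length PA c∈) (take-length-++ c (zeros b))

      drop-Ā : ∀ {c} → c ∈ A → drop a (c ++ zeros b) ≡ zeros b
      drop-Ā {c} c∈ =
        subst (λ m → drop m (c ++ zeros b) ≡ zeros b) (column-length PA c∈) (drop-length-++ c (zeros b))

      take-B̄ : ∀ c → take a (zeros a ++ c) ≡ zeros a
      take-B̄ c =
        subst (λ m → take m (zeros a ++ c) ≡ zeros a) (List.length-replicate a) (take-length-++ (zeros a) c)

      drop-B̄ : ∀ c → drop a (zeros a ++ c) ≡ c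
      drop-B̄ c =
        subst (λ m → drop m (zeros a ++ c) ≡ c) (List.length-replicate a) (drop-length-++ (zeros a) c)

      nonzero-before-Ā : ∀ {r} → r ∈ Ā → nonzero-before a r ≡ true
      nonzero-before-Ā r∈ with ∈-map⁻ (λ c → c ++ zeros b) r∈
      ... | c , c∈ , refl = trans (cong nonzeroCol (take-Ā c∈)) (column-nonzero PA c∈)

      nonzero-before-B̄ : ∀ {r} → r ∈ B̄ → nonzero-before a r ≡ false
      nonzero-before-B̄ r∈ with ∈-map⁻ (λ c → zeros a ++ c) r∈
      ... | c , _ , refl = trans (cong nonzeroCol (take-B̄ c)) (nonzeroCol-zeros a)

      Shuffled Split : Set
      Shuffled = F ≡ Ā × G ≡ B̄
      Split    = a + b ≡ n × map (take a) F ≡ A × map (drop a) G′ ≡ B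

      shuffled⇒split : Shuffled → Split
      shuffled⇒split (F≡Ā , G≡B̄) = width , take-F , drop-G′
        where
        width : a + b ≡ n
        width = trans (cong₂ _+_ (trans (sym (List.length-map _ A)) (cong length (sym F≡Ā)))
                                 (trans (sym (List.length-map _ B)) (cong length (sym G≡B̄))))
                      (length-filterB-not R)
        after≡not-before : ∀ {r} → r ∈ R → nonzero-after a r ≡ not (nonzero-before a r)
        after≡not-before {r} r∈ with nonzero-before a r in before
        ... | true with ∈-map⁻ _ (subst (r ∈_) F≡Ā (filterB-∈⁺ r∈ before))
        ...   | c , c∈ , refl = trans (cong nonzeroCol (drop-Ā c∈)) (nonzeroCol-zeros b)
        after≡not-before {r} r∈ | false
          with ∈-map⁻ _ (subst (r ∈_) G≡B̄ (filterB-∈⁺ {p = not ∘ nonzero-before a} r∈ (cong not before)))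
        ...   | c , c∈ , refl = trans (cong nonzeroCol (drop-B̄ c)) (column-nonzero PB c∈)
        take-F : map (take a) F ≡ A
        take-F = trans (cong (map (take a)) F≡Ā)
                       (trans (sym (List.map-∘ A)) (List.map-id-local (All.tabulate take-Ā)))
        drop-G′ : map (drop a) G′ ≡ B
        drop-G′ = trans (cong (map (drop a)) (trans (filterB-cong R after≡not-before) G≡B̄))
                        (trans (sym (List.map-∘ B)) (List.map-id-local (All.tabulate λ {c} _ → drop-B̄ c)))

      split⇒shuffled : Split → Shuffled
      split⇒shuffled (width , take-F , drop-G′) = F≡Ā , G≡B̄
        where
        open ≡-Reasoning
        a≤n : a ≤ n
        a≤n = subst (a ≤_) width (m≤m+n a b)
        length-take : ∀ {r} → r ∈ R → length (take a r) ≡ a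
        length-take {r} r∈ = trans (List.length-take a r)
                                   (trans (cong (a ⊓_) (column-length PR r∈)) (m≤n⇒m⊓n≡m a≤n))
        length-drop : ∀ {r} → r ∈ R → length (drop a r) ≡ b
        length-drop {r} r∈ = trans (List.length-drop a r)
                                   (trans (cong (_∸ a) (trans (column-length PR r∈) (sym width))) (m+n∸m≡n a b))
        cover : ∀ {r} → r ∈ R → nonzero-before a r ∨ nonzero-after a r ≡ true
        cover {r} r∈ = trans (sym (nonzeroCol-++ (take a r) (drop a r)))
                             (trans (cong nonzeroCol (List.take++drop≡id a r)) (column-nonzero PR r∈))
        exact : length F + length G′ ≡ n
        exact = trans (cong₂ _+_ (trans (sym (List.length-map (take a) F)) (cong length take-F))
                                 (trans (sym (List.length-map (drop a) G′)) (cong length drop-G′)))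
                      width
        after≡not-before : ∀ {r} → r ∈ R → nonzero-after a r ≡ not (nonzero-before a r)
        after≡not-before = exact-cover⇒complement R cover exact
        pad-below : ∀ {r} → r ∈ F → take a r ++ zeros b ≡ r
        pad-below {r} r∈F with filterB-∈⁻ {xs = R} r∈F
        ... | r∈ , before = trans (cong (take a r ++_) (sym (trans (¬nonzeroCol⇒zeros (drop a r) after)
                                                                   (cong zeros (length-drop r∈)))))
                                  (List.take++drop≡id a r)
          where
          after : nonzero-after a r ≡ false
          after = trans (after≡not-before r∈) (cong not before)
        pad-above : ∀ {r} → r ∈ G → zeros a ++ drop a r ≡ r
        pad-above {r} r∈G with filterB-∈⁻ {p = not ∘ nonzero-before a} {xs = R} r∈G
        ... | r∈ , not-before = trans (cong (_++ drop a r) (sym (trans (¬nonzeroCol⇒zeros (take a r) before)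
                                                                       (cong zeros (length-take r∈)))))
                                      (List.take++drop≡id a r)
          where
          before : nonzero-before a r ≡ false
          before = not-injective not-before
        F≡Ā : F ≡ Ā
        F≡Ā = begin
          F                                          ≡⟨ List.map-id-local (All.tabulate pad-below) ⟨
          map (λ r → take a r ++ zeros b) F          ≡⟨ List.map-∘ F ⟩
          map (λ c → c ++ zeros b) (map (take a) F) ≡⟨ cong (map (λ c → c ++ zeros b)) take-F ⟩
          Ā                                          ∎
        G≡B̄ : G ≡ B̄
        G≡B̄ = begin
          G                                           ≡⟨ List.map-id-local (All.tabulate pad-above) ⟨
          map (λ r → zeros a ++ drop a r) G           ≡⟨ List.map-∘ G ⟩
          map (λ c → zeros a ++ c) (map (drop a) G)  ≡⟨ cong (map (λ c → zeros a ++ c) ∘ map (drop a))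
                                                             (filterB-cong R after≡not-before) ⟨
          map (λ c → zeros a ++ c) (map (drop a) G′) ≡⟨ cong (map (λ c → zeros a ++ c)) drop-G′ ⟩
          B̄                                           ∎

      shuffled⇔split : Shuffled ⇔ Split
      shuffled⇔split = mk⇔ shuffled⇒split split⇒shuffled

  -- Column decompositions

  module _ {k : ℕ} where

    rows-take : ∀ h a (M : RawMat k) → rows h (take a M) ≡ map (take a) (rows h M)
    rows-take h a M = trans (List.map-cong (λ i → sym (List.take-map a M)) (upTo h)) (List.map-∘ (upTo h))

    rows-drop : ∀ h a (M : RawMat k) → rows h (drop a M) ≡ map (drop a) (rows h M)
    rows-drop h a M = trans (List.map-cong (λ i → sym (List.drop-map a M)) (upTo h)) (List.map-∘ (upTo h))

    length-cp : ∀ h (X : RawMat k) → (∀ {c} → c ∈ X → nonzeroCol c ≡ true) → length (cp h X) ≡ length X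
    length-cp h X nz = trans (cong length (cp-nonzero-columns h X nz)) (length-rows _ _)

    IsTransposePair : RawMat k → RawMat k → RawMat k × RawMat k → Bool
    IsTransposePair A B (L , R) = does (L ≟M transposeM A) ∧ does (R ≟M transposeM B)

    module Decomposition {M A B : RawMat k} (PM : Packed M) (PA : Packed A) (PB : Packed B) where

      open RowSplitting PA PB (transpose-Packed M PM) public

      decomposes-at : ℕ → Bool
      decomposes-at j = IsTransposePair A B (cp (length M) (take j M) , cp (length M) (drop j M))

      Decomposes : Set
      Decomposes = cp (length M) (take a M) ≡ transposeM A × cp (length M) (drop a M) ≡ transposeM B

      decomposes? : Dec Decomposes
      decomposes? = (cp (length M) (take a M) ≟M transposeM A)
              ×-dec (cp (length M) (drop a M) ≟M transposeM B)

      shuffled? : Dec Shuffled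
      shuffled? = splits? (List.≡-dec Fin._≟_) (nonzero-before a) (transposeM M) Ā B̄

      length-cp-take : ∀ j → length (cp (length M) (take j M)) ≡ j ⊓ length M
      length-cp-take j = trans (length-cp (length M) (take j M) (column-nonzero PM ∘ ∈-take⁻ j))
                               (List.length-take j M)

      square-if-transpose : ∀ {L C : RawMat k} → Packed C → does (L ≟M transposeM C) ≡ true →
                            isSquare L ≡ true
      square-if-transpose {L} {C} P e = trans (cong isSquare (does⇒ (L ≟M transposeM C) e))
                                              (Packed⇒isSquare {M = transposeM C} (transpose-Packed C P))

      count-decompositions : count (IsTransposePair A B) (decompositions M) ≡ indicator (does decomposes?)
      count-decompositions = trans
        (count-concatMap (IsTransposePair A B) decomposes-at candidate (upTo (suc (length M)))
                         λ j → count-if-singleton (IsTransposePair A B) (both-square j) (blocks j) (squares j))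
        (count-upTo-unique decomposes-at a (suc (length M)) unique bound)
        where
        blocks : ℕ → RawMat k × RawMat k
        blocks j = cp (length M) (take j M) , cp (length M) (drop j M)
        both-square : ℕ → Bool
        both-square j = isSquare (proj₁ (blocks j)) ∧ isSquare (proj₂ (blocks j))
        candidate : ℕ → List (RawMat k × RawMat k)
        candidate j = if both-square j then [ blocks j ] else []
        width-of-left : ∀ j → decomposes-at j ≡ true → j ⊓ length M ≡ a
        width-of-left j d = trans (sym (length-cp-take j))
                                  (trans (cong length (does⇒ (proj₁ (blocks j) ≟M transposeM A) left))
                                         (length-rows (length A) A))
          where
          left = ∧-conicalˡ (does (proj₁ (blocks j) ≟M transposeM A)) _ d
        squares : ∀ j → decomposes-at j ≡ true → both-square j ≡ true
        squares j d = cong₂ _∧_ (square-if-transpose {L = proj₁ (blocks j)} PA (∧-conicalˡ _ _ d))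
                                (square-if-transpose {L = proj₂ (blocks j)} PB (∧-conicalʳ _ _ d))
        unique : ∀ j → j < suc (length M) → decomposes-at j ≡ true → j ≡ a
        unique j j< d = trans (sym (m≤n⇒m⊓n≡m (≤-pred j<))) (width-of-left j d)
        bound : decomposes-at a ≡ true → a < suc (length M)
        bound d = s≤s (m⊓n≡m⇒m≤n (width-of-left a d))

      nonzero-rows-take : filterB nonzeroCol (rows (length M) (take a M)) ≡ map (take a) F
      nonzero-rows-take = trans (cong (filterB nonzeroCol) (rows-take (length M) a M))
                                (filterB-map nonzeroCol (take a) (transposeM M))

      nonzero-rows-drop : filterB nonzeroCol (rows (length M) (drop a M)) ≡ map (drop a) G′
      nonzero-rows-drop = trans (cong (filterB nonzeroCol) (rows-drop (length M) a M))
                                (filterB-map nonzeroCol (drop a) (transposeM M))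

      decomposes⇔split : Decomposes ⇔ Split
      decomposes⇔split = mk⇔ ⇒ ⇐
        where
        left  = cp≡transpose⇔ (length M) (take a M) A (column-nonzero PM ∘ ∈-take⁻ a) PA
        right = cp≡transpose⇔ (length M) (drop a M) B (column-nonzero PM ∘ ∈-drop⁻ a) PB
        lengths = block-lengths⇔ a b M
        n≡|M| : n ≡ length M
        n≡|M| = length-rows (length M) M
        ⇒ : Decomposes → Split
        ⇒ (l , r) with Equivalence.to left l | Equivalence.to right r
        ... | |l| , el | |r| , er = trans (Equivalence.to lengths (|l| , |r|)) (sym n≡|M|)
                                  , trans (sym nonzero-rows-take) el
                                  , trans (sym nonzero-rows-drop) er
        ⇐ : Split → Decomposes
        ⇐ (width , eF , eG′) with Equivalence.from lengths (trans width n≡|M|)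
        ... | |l| , |r| = Equivalence.from left (|l| , trans nonzero-rows-take eF)
                        , Equivalence.from right (|r| , trans nonzero-rows-drop eG′)

      shuffled⇔decomposes : Shuffled ⇔ Decomposes
      shuffled⇔decomposes = mk⇔ (Equivalence.from decomposes⇔split ∘ shuffled⇒split)
                                (split⇒shuffled ∘ Equivalence.to decomposes⇔split)

    count-shuffles≡count-decompositions : ∀ {M A B : RawMat k} → Packed M → Packed A → Packed B →
      count (λ N → does (N ≟M transposeM M)) (shiftedShuffle A B) ≡
      count (IsTransposePair A B) (decompositions M)
    count-shuffles≡count-decompositions {M} {A} {B} PM PA PB = begin
      count (λ N → does (N ≟M transposeM M)) (shiftedShuffle A B)
        ≡⟨ count-shuffles (List.≡-dec Fin._≟_) (nonzero-before a) {k} Ā B̄ (transposeM M)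
                          nonzero-before-Ā nonzero-before-B̄ ⟩
      indicator (does shuffled?)
        ≡⟨ cong indicator (does-⇔ shuffled⇔decomposes shuffled? decomposes?) ⟩
      indicator (does decomposes?)
        ≡⟨ count-decompositions ⟨
      count (IsTransposePair A B) (decompositions M) ∎
      where
      open ≡-Reasoning
      open Decomposition PM PA PB

module Sums {c ℓ} (R : CommutativeRing c ℓ) where

  open CommutativeRing R
  open import Algebra.Properties.Monoid.Mult +-monoid public using (×-congˡ) renaming (_×_ to _·ℕ_)
  open import Algebra.Properties.CommutativeSemigroup +-commutativeSemigroup using (interchange)
  open Combinatorics using (count)

  sum : ∀ {a} {X : Set a} → (X → Carrier) → List X → Carrier
  sum f = foldr (λ x s → f x + s) 0#

  module _ {a} {X : Set a} where

    sum-cong : ∀ {f g : X → Carrier} xs → (∀ x → f x ≈ g x) → sum f xs ≈ sum g xs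
    sum-cong []       _ = refl
    sum-cong (x ∷ xs) h = +-cong (h x) (sum-cong xs h)

    sum-++ : ∀ (f : X → Carrier) xs ys → sum f (xs ++ ys) ≈ sum f xs + sum f ys
    sum-++ f []       ys = sym (+-identityˡ _)
    sum-++ f (x ∷ xs) ys = trans (+-congˡ (sum-++ f xs ys)) (sym (+-assoc _ _ _))

    sum-0 : ∀ (xs : List X) → sum (λ _ → 0#) xs ≈ 0#
    sum-0 []       = refl
    sum-0 (x ∷ xs) = trans (+-identityˡ _) (sum-0 xs)

    sum-+ : ∀ (f g : X → Carrier) xs → sum (λ x → f x + g x) xs ≈ sum f xs + sum g xs
    sum-+ f g []       = sym (+-identityˡ _)
    sum-+ f g (x ∷ xs) = trans (+-congˡ (sum-+ f g xs)) (interchange _ _ _ _)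

    *-sumˡ : ∀ a (f : X → Carrier) xs → a * sum f xs ≈ sum (λ x → a * f x) xs
    *-sumˡ a f []       = zeroʳ a
    *-sumˡ a f (x ∷ xs) = trans (distribˡ _ _ _) (+-congˡ (*-sumˡ a f xs))

    *-sumʳ : ∀ a (f : X → Carrier) xs → sum f xs * a ≈ sum (λ x → f x * a) xs
    *-sumʳ a f []       = zeroˡ a
    *-sumʳ a f (x ∷ xs) = trans (distribʳ _ _ _) (+-congˡ (*-sumʳ a f xs))

  module _ {a b} {X : Set a} {Y : Set b} where

    sum-map : ∀ (f : Y → Carrier) (g : X → Y) xs → sum f (map g xs) ≡ sum (f ∘ g) xs
    sum-map f g []       = ≡.refl
    sum-map f g (x ∷ xs) = ≡.cong (f (g x) +_) (sum-map f g xs)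

    sum-concatMap : ∀ (f : Y → Carrier) (g : X → List Y) xs →
                    sum f (concatMap g xs) ≈ sum (λ x → sum f (g x)) xs
    sum-concatMap f g []       = refl
    sum-concatMap f g (x ∷ xs) = trans (sum-++ f (g x) (concatMap g xs)) (+-congˡ (sum-concatMap f g xs))

    sum-swap : ∀ (h : X → Y → Carrier) xs ys →
               sum (λ x → sum (h x) ys) xs ≈ sum (λ y → sum (λ x → h x y) xs) ys
    sum-swap h []       ys = sym (sum-0 ys)
    sum-swap h (x ∷ xs) ys = trans (+-congˡ (sum-swap h xs ys)) (sym (sum-+ (h x) _ ys))

    sum-*-sum : ∀ (f : X → Carrier) (g : Y → Carrier) xs ys →
                sum f xs * sum g ys ≈ sum (λ x → sum (λ y → f x * g y) ys) xs
    sum-*-sum f g xs ys = trans (*-sumʳ _ f xs) (sum-cong xs λ x → *-sumˡ (f x) g ys)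

  if-*ˡ : ∀ b a x → (if b then a * x else 0#) ≈ a * (if b then x else 0#)
  if-*ˡ true  a x = refl
  if-*ˡ false a x = sym (zeroʳ a)

  if-*-if : ∀ b b′ x y → (if b then x else 0#) * (if b′ then y else 0#) ≈ (if b ∧ b′ then x * y else 0#)
  if-*-if true  true  x y = refl
  if-*-if true  false x y = zeroʳ x
  if-*-if false _     x y = zeroˡ _

  sum-indicator : ∀ {X : Set} (p : X → Bool) a xs →
                  sum (λ x → if p x then a else 0#) xs ≈ count p xs ·ℕ a
  sum-indicator p a []       = refl
  sum-indicator p a (x ∷ xs) with p x
  ... | true  = +-congˡ (sum-indicator p a xs)
  ... | false = trans (+-identityˡ _) (sum-indicator p a xs)

module Transposition {c ℓ} (K : Field c ℓ) (k : ℕ) where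

  open Field K
  open PM K k
  open Sums commutativeRing
  open Combinatorics
  open import Data.Bool.Properties using (T?; T-irrelevant; ∧-conicalˡ; ∧-conicalʳ; ¬-not)
  open import Relation.Nullary.Decidable using (does-⇔)
  open import Data.Nat using () renaming (_+_ to _+ℕ_)
  import Relation.Binary.Reasoning.Setoid as SetoidReasoning

  packed : (X : Basis) → Packed (raw X)
  packed (M , t) = T⇒Packed M t

  _≐_ : Basis → Basis → Bool
  X ≐ Y = does (raw X ≟M raw Y)

  transposeᴮ : Basis → Basis
  transposeᴮ X = transposeM (raw X) , Packed⇒T (transposeM (raw X)) (transpose-Packed (raw X) (packed X))

  basis-≡ : ∀ {X Y : Basis} → raw X ≡ raw Y → X ≡ Y
  basis-≡ {M , s} {.M , t} ≡.refl = ≡.cong (M ,_) (T-irrelevant s t)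

  transposeᴮ-involutive : ∀ X → transposeᴮ (transposeᴮ X) ≡ X
  transposeᴮ-involutive X = basis-≡ (transpose-involutive (packed X))

  ≐-sym : ∀ X Y → (X ≐ Y) ≡ (Y ≐ X)
  ≐-sym X Y = does-⇔ (mk⇔ ≡.sym ≡.sym) (raw X ≟M raw Y) (raw Y ≟M raw X)

  ≐-transpose : ∀ X Y → (transposeᴮ X ≐ Y) ≡ (X ≐ transposeᴮ Y)
  ≐-transpose X Y = does-⇔ (mk⇔ ⇒ ⇐) (raw (transposeᴮ X) ≟M raw Y) (raw X ≟M raw (transposeᴮ Y))
    where
    ⇒ : raw (transposeᴮ X) ≡ raw Y → raw X ≡ raw (transposeᴮ Y)
    ⇒ e = ≡.trans (≡.sym (≡.cong raw (transposeᴮ-involutive X))) (≡.cong transposeM e)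
    ⇐ : raw X ≡ raw (transposeᴮ Y) → raw (transposeᴮ X) ≡ raw Y
    ⇐ e = ≡.trans (≡.cong transposeM e) (≡.cong raw (transposeᴮ-involutive Y))

  ≐-transpose′ : ∀ X Y → (X ≐ transposeᴮ Y) ≡ (Y ≐ transposeᴮ X)
  ≐-transpose′ X Y = ≡.trans (≐-sym X (transposeᴮ Y)) (≐-transpose Y X)

  toBasis-packed : ∀ M (t : T (isPacked M)) → toBasis M ≡ just (M , t)
  toBasis-packed M t with T? (isPacked M)
  ... | yes s = ≡.cong (λ s → just (M , s)) (T-irrelevant s t)
  ... | no ¬t = contradiction t ¬t

  transposeB≡transposeᴮ : ∀ X → transposeB X ≡ just (transposeᴮ X)
  transposeB≡transposeᴮ X = toBasis-packed _ _

  coeff-φ : ∀ u M → coeff (φ u) M ≡ coeff u (transposeᴮ M)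
  coeff-φ []            M = ≡.refl
  coeff-φ ((a , N) ∷ u) M rewrite transposeB≡transposeᴮ N =
    ≡.cong₂ _+_ (≡.cong (λ b → if b then a else 0#) (≐-transpose N M)) (coeff-φ u M)

  coeff₂-φ⊗φ : ∀ t A B → coeff₂ (φ⊗φ t) A B ≡ coeff₂ t (transposeᴮ A) (transposeᴮ B)
  coeff₂-φ⊗φ []                A B = ≡.refl
  coeff₂-φ⊗φ ((a , L , R) ∷ t) A B rewrite transposeB≡transposeᴮ L | transposeB≡transposeᴮ R =
    ≡.cong₂ _+_ (≡.cong₂ (λ b b′ → if b ∧ b′ then a else 0#) (≐-transpose L A) (≐-transpose R B))
                (coeff₂-φ⊗φ t A B)

  coeff-++ : ∀ u v M → coeff (u ++ v) M ≈ coeff u M + coeff v M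
  coeff-++ u v M = sum-++ (λ (a , N) → if N ≐ M then a else 0#) u v

  coeff-scale : ∀ a u M → coeff (scale a u) M ≈ a * coeff u M
  coeff-scale a u M = trans (reflexive (sum-map _ _ u)) (trans
    (sum-cong u λ (b , N) → if-*ˡ (N ≐ M) a b)
    (sym (*-sumˡ a (λ (b , N) → if N ≐ M then b else 0#) u)))

  sum-coeff : ∀ {X : Set} (f : X → Basis) xs u →
              sum (λ x → coeff u (f x)) xs ≈ sum (λ (a , A) → count (λ x → A ≐ f x) xs ·ℕ a) u
  sum-coeff f xs u = trans (sum-swap (λ x (a , A) → if A ≐ f x then a else 0#) xs u)
                           (sum-cong u λ (a , A) → sum-indicator (λ x → A ≐ f x) a xs)

  sum-coeff-* : ∀ {X : Set} (f g : X → Basis) xs u v →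
    sum (λ x → coeff u (f x) * coeff v (g x)) xs ≈
    sum (λ (a , A) → sum (λ (b , B) → count (λ x → (A ≐ f x) ∧ (B ≐ g x)) xs ·ℕ (a * b)) v) u
  sum-coeff-* {X} f g xs u v = begin
    sum (λ x → coeff u (f x) * coeff v (g x)) xs
      ≈⟨ sum-cong xs (λ x → trans (sum-*-sum _ _ u v)
                                  (sum-cong u λ (a , A) → sum-cong v λ (b , B) → if-*-if (A ≐ f x) (B ≐ g x) a b)) ⟩
    sum (λ x → sum (λ (a , A) → sum (λ (b , B) → term a A b B x) v) u) xs
      ≈⟨ sum-swap (λ x (a , A) → sum (λ (b , B) → term a A b B x) v) xs u ⟩
    sum (λ (a , A) → sum (λ x → sum (λ (b , B) → term a A b B x) v) xs) u
      ≈⟨ sum-cong u (λ (a , A) → trans (sum-swap (λ x (b , B) → term a A b B x) xs v)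
                                       (sum-cong v λ (b , B) → sum-indicator _ (a * b) xs)) ⟩
    sum (λ (a , A) → sum (λ (b , B) → count (λ x → (A ≐ f x) ∧ (B ≐ g x)) xs ·ℕ (a * b)) v) u ∎
    where
    open SetoidReasoning setoid
    term : Carrier → Basis → Carrier → Basis → X → Carrier
    term a A b B x = if (A ≐ f x) ∧ (B ≐ g x) then a * b else 0#

  packed-if-≡-transpose : ∀ X {N} → N ≡ transposeM (raw X) → T (isPacked N)
  packed-if-≡-transpose X e = ≡.subst (T ∘ isPacked) (≡.sym e) (proj₂ (transposeᴮ X))

  count-basisList : ∀ (p : RawMat k → Bool) xs → (∀ N → p N ≡ true → T (isPacked N)) →
                    count (p ∘ raw) (basisList xs) ≡ count p xs
  count-basisList p xs packed-if =
    ≡.trans (count-mapMaybe (p ∘ raw) toBasis xs) (count-cong xs λ {N} _ → lift N)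
    where
    lift : ∀ N → maybe (p ∘ raw) false (toBasis N) ≡ p N
    lift N with T? (isPacked N)
    ... | yes _ = ≡.refl
    ... | no ¬t = ≡.sym (¬-not λ pN → ¬t (packed-if N pN))

  count-basisPairs : ∀ (p : RawMat k × RawMat k → Bool) xs →
                     (∀ L R → p (L , R) ≡ true → T (isPacked L) × T (isPacked R)) →
                     count (p ∘ Data.Product.map raw raw) (basisPairs xs) ≡ count p xs
  count-basisPairs p []             _      = ≡.refl
  count-basisPairs p ((L , R) ∷ xs) packed-if with T? (isPacked L) | T? (isPacked R)
  ... | yes _  | yes _  = ≡.cong (indicator (p (L , R)) +ℕ_) (count-basisPairs p xs packed-if)
  ... | yes _  | no ¬tR rewrite ¬-not {p (L , R)} (λ pLR → ¬tR (proj₂ (packed-if L R pLR))) =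
    count-basisPairs p xs packed-if
  ... | no ¬tL | _      rewrite ¬-not {p (L , R)} (λ pLR → ¬tL (proj₁ (packed-if L R pLR))) =
    count-basisPairs p xs packed-if

  -- The coefficient of F_N in F_A · F_B.
  shuffleCount : Basis → Basis → Basis → ℕ
  shuffleCount A B N = count (_≐ N) (basisList (shiftedShuffle (raw A) (raw B)))

  -- The coefficient of F_L ⊗ F_R in Δ F_M.
  splitCount : Basis → Basis → Basis → ℕ
  splitCount M L R = count (λ (L′ , R′) → (L′ ≐ L) ∧ (R′ ≐ R)) (basisPairs (decompositions (raw M)))

  shuffleCount≡splitCount : ∀ A B M →
                            shuffleCount A B (transposeᴮ M) ≡ splitCount M (transposeᴮ A) (transposeᴮ B)
  shuffleCount≡splitCount A B M = begin
    shuffleCount A B (transposeᴮ M)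
      ≡⟨ count-basisList (λ N → does (N ≟M transposeM (raw M))) (shiftedShuffle (raw A) (raw B))
                         (λ N e → packed-if-≡-transpose M (does⇒ (N ≟M transposeM (raw M)) e)) ⟩
    count (λ N → does (N ≟M transposeM (raw M))) (shiftedShuffle (raw A) (raw B))
      ≡⟨ count-shuffles≡count-decompositions (packed M) (packed A) (packed B) ⟩
    count (IsTransposePair (raw A) (raw B)) (decompositions (raw M))
      ≡⟨ count-basisPairs (IsTransposePair (raw A) (raw B)) (decompositions (raw M)) transposes-packed ⟨
    splitCount M (transposeᴮ A) (transposeᴮ B) ∎
    where
    open ≡.≡-Reasoning
    transposes-packed : ∀ L R → IsTransposePair (raw A) (raw B) (L , R) ≡ true →
                        T (isPacked L) × T (isPacked R)
    transposes-packed L R e =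
      packed-if-≡-transpose A (does⇒ (L ≟M transposeM (raw A)) (∧-conicalˡ _ _ e)) ,
      packed-if-≡-transpose B (does⇒ (R ≟M transposeM (raw B)) (∧-conicalʳ _ _ e))

  coeff-mul : ∀ u v N →
    coeff (mul u v) N ≈ sum (λ (a , A) → sum (λ (b , B) → shuffleCount A B N ·ℕ (a * b)) v) u
  coeff-mul u v N =
    trans (sum-concatMap _ _ u) (sum-cong u λ (a , A) →
    trans (sum-concatMap _ _ v) (sum-cong v λ (b , B) →
    trans (reflexive (sum-map _ _ (basisList (shiftedShuffle (raw A) (raw B)))))
          (sum-indicator (_≐ N) (a * b) (basisList (shiftedShuffle (raw A) (raw B))))))

  coeff₂-Δ : ∀ u L R → coeff₂ (Δ u) L R ≈ sum (λ (a , M) → splitCount M L R ·ℕ a) u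
  coeff₂-Δ u L R = trans (sum-concatMap _ _ u) (sum-cong u λ (a , M) →
    trans (reflexive (sum-map _ _ (basisPairs (decompositions (raw M)))))
          (sum-indicator (λ (L′ , R′) → (L′ ≐ L) ∧ (R′ ≐ R)) a (basisPairs (decompositions (raw M)))))

  ·⋆-sum : ∀ f g M → (f ·⋆ g) M ≈ sum (λ (L , R) → f L * g R) (basisPairs (decompositions (raw M)))
  ·⋆-sum f g M =
    trans (reflexive (≡.trans (≡.cong (sum term) (List.++-identityʳ (map (λ (L , R) → 1# , L , R) pairs)))
                              (sum-map term (λ (L , R) → 1# , L , R) pairs)))
          (sum-cong pairs λ _ → *-identityˡ _)
    where
    pairs : List (Basis × Basis)
    pairs = basisPairs (decompositions (raw M))
    term : Carrier × Basis × Basis → Carrier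
    term (a , L , R) = a * (f L * g R)

  Δ⋆-sum : ∀ f A B → Δ⋆ f A B ≈ sum f (basisList (shiftedShuffle (raw A) (raw B)))
  Δ⋆-sum f A B =
    trans (reflexive (≡.trans (≡.cong (sum term) (≡.trans (List.++-identityʳ (terms ++ []))
                                                           (List.++-identityʳ terms)))
                              (sum-map term (λ N → 1# * 1# , N) shuffled)))
          (sum-cong shuffled λ _ → trans (*-congʳ (*-identityˡ 1#)) (*-identityˡ _))
    where
    shuffled : List Basis
    shuffled = basisList (shiftedShuffle (raw A) (raw B))
    terms : List (Carrier × Basis)
    terms = map (λ N → 1# * 1# , N) shuffled
    term : Carrier × Basis → Carrier
    term (c , N) = c * f N

  φ-additive : ∀ u v M → ⟦ φ (u ++ v) ⟧ M ≈ ⟦ φ u ⟧ M + ⟦ φ v ⟧ M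
  φ-additive u v M = trans (reflexive (coeff-φ (u ++ v) M)) (trans (coeff-++ u v (transposeᴮ M))
    (+-cong (reflexive (≡.sym (coeff-φ u M))) (reflexive (≡.sym (coeff-φ v M)))))

  φ-homogeneous : ∀ a u M → ⟦ φ (scale a u) ⟧ M ≈ a * ⟦ φ u ⟧ M
  φ-homogeneous a u M = trans (reflexive (coeff-φ (scale a u) M)) (trans (coeff-scale a u (transposeᴮ M))
    (*-congˡ (reflexive (≡.sym (coeff-φ u M)))))

  coeff≡coeff-φ : ∀ u M → coeff u M ≡ coeff (φ u) (transposeᴮ M)
  coeff≡coeff-φ u M =
    ≡.trans (≡.cong (coeff u) (≡.sym (transposeᴮ-involutive M))) (≡.sym (coeff-φ u (transposeᴮ M)))

  φ-injective : ∀ u v → (∀ M → ⟦ φ u ⟧ M ≈ ⟦ φ v ⟧ M) → ∀ M → coeff u M ≈ coeff v M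
  φ-injective u v h M =
    trans (reflexive (coeff≡coeff-φ u M)) (trans (h (transposeᴮ M)) (reflexive (≡.sym (coeff≡coeff-φ v M))))

  φ-surjective : ∀ f → Σ PMk (λ u → ∀ M → ⟦ φ u ⟧ M ≈ ⟦ f ⟧ M)
  φ-surjective f = φ f , λ M → reflexive (≡.trans (coeff-φ (φ f) M)
                                         (≡.sym (coeff≡coeff-φ f M)))

  φ-one : ∀ M → ⟦ φ one ⟧ M ≈ one⋆ M
  φ-one M = +-congʳ (reflexive (≡.cong (λ b → if b then 1# else 0#) (≐-sym ∅ M)))

  -- transposeᴮ ∅ reduces to ∅, since T true is ⊤ and has η.
  φ-ε : ∀ u → ε⋆ ⟦ φ u ⟧ ≈ ε u
  φ-ε u = trans (+-identityʳ _) (trans (*-identityˡ _) (reflexive (coeff-φ u ∅)))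

  ·⋆-φ : ∀ u v M → (⟦ φ u ⟧ ·⋆ ⟦ φ v ⟧) M ≈
         sum (λ (a , A) → sum (λ (b , B) → splitCount M (transposeᴮ A) (transposeᴮ B) ·ℕ (a * b)) v) u
  ·⋆-φ u v M = begin
    (⟦ φ u ⟧ ·⋆ ⟦ φ v ⟧) M
      ≈⟨ ·⋆-sum ⟦ φ u ⟧ ⟦ φ v ⟧ M ⟩
    sum (λ (L , R) → coeff (φ u) L * coeff (φ v) R) pairs
      ≈⟨ sum-cong pairs (λ (L , R) → reflexive (≡.cong₂ _*_ (coeff-φ u L) (coeff-φ v R))) ⟩
    sum (λ (L , R) → coeff u (transposeᴮ L) * coeff v (transposeᴮ R)) pairs
      ≈⟨ sum-coeff-* (transposeᴮ ∘ proj₁) (transposeᴮ ∘ proj₂) pairs u v ⟩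
    sum (λ (a , A) → sum (λ (b , B) →
      count (λ (L , R) → (A ≐ transposeᴮ L) ∧ (B ≐ transposeᴮ R)) pairs ·ℕ (a * b)) v) u
      ≈⟨ sum-cong u (λ (a , A) → sum-cong v λ (b , B) → ×-congˡ (count-cong pairs λ {(L , R)} _ →
           ≡.cong₂ _∧_ (≐-transpose′ A L) (≐-transpose′ B R))) ⟩
    sum (λ (a , A) → sum (λ (b , B) → splitCount M (transposeᴮ A) (transposeᴮ B) ·ℕ (a * b)) v) u ∎
    where
    open SetoidReasoning setoid
    pairs : List (Basis × Basis)
    pairs = basisPairs (decompositions (raw M))

  φ-mul : ∀ u v M → ⟦ φ (mul u v) ⟧ M ≈ (⟦ φ u ⟧ ·⋆ ⟦ φ v ⟧) M
  φ-mul u v M = begin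
    coeff (φ (mul u v)) M
      ≡⟨ coeff-φ (mul u v) M ⟩
    coeff (mul u v) (transposeᴮ M)
      ≈⟨ coeff-mul u v (transposeᴮ M) ⟩
    sum (λ (a , A) → sum (λ (b , B) → shuffleCount A B (transposeᴮ M) ·ℕ (a * b)) v) u
      ≈⟨ sum-cong u (λ (a , A) → sum-cong v λ (b , B) → ×-congˡ (shuffleCount≡splitCount A B M)) ⟩
    sum (λ (a , A) → sum (λ (b , B) → splitCount M (transposeᴮ A) (transposeᴮ B) ·ℕ (a * b)) v) u
      ≈⟨ ·⋆-φ u v M ⟨
    (⟦ φ u ⟧ ·⋆ ⟦ φ v ⟧) M ∎
    where open SetoidReasoning setoid

  φ-Δ : ∀ u A B → Δ⋆ ⟦ φ u ⟧ A B ≈ ⟦ φ⊗φ (Δ u) ⟧₂ A B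
  φ-Δ u A B = begin
    Δ⋆ ⟦ φ u ⟧ A B
      ≈⟨ Δ⋆-sum ⟦ φ u ⟧ A B ⟩
    sum (coeff (φ u)) shuffled
      ≈⟨ sum-cong shuffled (λ N → reflexive (coeff-φ u N)) ⟩
    sum (λ N → coeff u (transposeᴮ N)) shuffled
      ≈⟨ sum-coeff transposeᴮ shuffled u ⟩
    sum (λ (a , M) → count (λ N → M ≐ transposeᴮ N) shuffled ·ℕ a) u
      ≈⟨ sum-cong u (λ (a , M) → ×-congˡ (≡.trans (count-cong shuffled λ {N} _ → ≐-transpose′ M N)
                                                   (shuffleCount≡splitCount A B M))) ⟩
    sum (λ (a , M) → splitCount M (transposeᴮ A) (transposeᴮ B) ·ℕ a) u
      ≈⟨ coeff₂-Δ u (transposeᴮ A) (transposeᴮ B) ⟨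
    coeff₂ (Δ u) (transposeᴮ A) (transposeᴮ B)
      ≡⟨ coeff₂-φ⊗φ (Δ u) A B ⟨
    ⟦ φ⊗φ (Δ u) ⟧₂ A B ∎
    where
    open SetoidReasoning setoid
    shuffled : List Basis
    shuffled = basisList (shiftedShuffle (raw A) (raw B))

proposition2p5 : ∀ {c ℓ} (K : Field c ℓ) → CharacteristicZero K →
    (k : ℕ) → 1 ≤ k → PM.PhiIsHopfIsomorphism K k
proposition2p5 K _ k _ = record
  { φ-additive    = φ-additive
  ; φ-homogeneous = φ-homogeneous
  ; φ-injective   = φ-injective
  ; φ-surjective  = φ-surjective
  ; φ-mul         = φ-mul
  ; φ-one         = φ-one
  ; φ-Δ           = φ-Δ
  ; φ-ε           = φ-ε
  }
  where open Transposition K k
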